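{- Let $n\ge 5$, let $u,v\in V(Q_n)$ be vertices of opposite parity and let $M$ be a matching of $Q_n$. If any of the conditions C1, C2, C3 holds, then there is no Hamilton path of $Q_n$ between $u$ and $v$ containing all edges of $M$.
   Context: $Q_n$ has vertex set $\{0,1\}^n$, two vertices adjacent iff they differ in exactly one coordinate; the parity of a vertex is the parity of its number of ones. For a vertex $x$ and $i\in[n]$, $x^i$ denotes the vertex obtained by flipping coordinate $i$; edge $xx^i$ has direction $i$. A half-layer in direction $i$ is a set of the form $\{x x^i : x_i = 0,\ x \text{ has parity } p\}$ for a fixed parity $p$. For a vertex $u$, a $u$-avoiding almost half-layer in direction $i$ is $H\setminus\{uu^i\}$ where $H$ is the half-layer in direction $i$ containing $uu^i$. A vertex is covered by a set of edges if it is an endpoint of one of them. The C-conditions: C1: $M$ contains (as a subset) a half-layer $H$ and both $u$ and $v$ are covered by $H$. C2: there are directions $i\ne j$ such that $v=u^i$, $M$ contains the $u$-avoiding almost half-layer in direction $i$, and $uu^j\in M$ and $vv^j\in M$. C3: $uv\in M$. -}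

module Defs where

open import Data.Bool using (Bool; true; false; not; _xor_)
open import Data.Nat using (ℕ)
open import Data.Fin using (Fin)
open import Data.Vec using (Vec; lookup; foldr; _[_]%=_)
open import Data.List using (List; _∷_; []; _++_; head; last)
open import Data.Maybe using (just)
open import Data.Product using (Σ; ∃; ∃-syntax; _×_; _,_)
open import Data.Sum using (_⊎_)
open import Relation.Binary.PropositionalEquality using (_≡_; _≢_)
open import Relation.Nullary using (¬_)
open import Data.List.Membership.Propositional using (_∈_)
open import Data.List.Relation.Unary.Unique.Propositional using (Unique)
open import Data.List.Relation.Unary.Linked using (Linked)

-- Vertices of Q_n : {0,1}^n, with false = 0, true = 1.
Vertex : ℕ → Set
Vertex n = Vec Bool n

flipAt : ∀ {n} → Vertex n → Fin n → Vertex n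
flipAt x i = x [ i ]%= not

parity : ∀ {n} → Vertex n → Bool
parity = foldr _ _xor_ false

Adjacent : ∀ {n} → Vertex n → Vertex n → Set
Adjacent x y = ∃[ i ] (y ≡ flipAt x i)

-- An edge of Q_n, written canonically as x x^i with x_i = 0
-- (so every edge has exactly one representation).
record Edge (n : ℕ) : Set where
  constructor edge
  field
    low  : Vertex n
    dir  : Fin n
    low0 : lookup low dir ≡ false

open Edge public

high : ∀ {n} → Edge n → Vertex n
high e = flipAt (low e) (dir e)

Endpoint : ∀ {n} → Edge n → Vertex n → Set
Endpoint e w = (w ≡ low e) ⊎ (w ≡ high e)

Joins : ∀ {n} → Edge n → Vertex n → Vertex n → Set
Joins e a b = (a ≡ low e × b ≡ high e) ⊎ (a ≡ high e × b ≡ low e)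

EdgeSet : ℕ → Set₁
EdgeSet n = Edge n → Set

EdgeIn : ∀ {n} → EdgeSet n → Vertex n → Vertex n → Set
EdgeIn M a b = ∃[ e ] (M e × Joins e a b)

IsMatching : ∀ {n} → EdgeSet n → Set
IsMatching M = ∀ e f → M e → M f → ∀ w → Endpoint e w → Endpoint f w →
               (low e ≡ low f × dir e ≡ dir f)

_⊆ₑ_ : ∀ {n} → EdgeSet n → EdgeSet n → Set
A ⊆ₑ B = ∀ e → A e → B e

HalfLayer : ∀ {n} → Fin n → Bool → EdgeSet n
HalfLayer i p e = (dir e ≡ i) × (parity (low e) ≡ p)

Covered : ∀ {n} → EdgeSet n → Vertex n → Set
Covered H w = ∃[ e ] (H e × Endpoint e w)

lowEnd : ∀ {n} → Vertex n → Fin n → Vertex n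
lowEnd u i with lookup u i
... | true  = flipAt u i
... | false = u

-- u-avoiding almost half-layer in direction i: H \ {u u^i},
-- H the half-layer in direction i containing u u^i
AlmostHalfLayer : ∀ {n} → Vertex n → Fin n → EdgeSet n
AlmostHalfLayer u i e =
  HalfLayer i (parity (lowEnd u i)) e × ¬ Joins e u (flipAt u i)

C1 : ∀ {n} → EdgeSet n → Vertex n → Vertex n → Set
C1 M u v = ∃[ i ] ∃[ p ]
  (HalfLayer i p ⊆ₑ M × Covered (HalfLayer i p) u × Covered (HalfLayer i p) v)

C2 : ∀ {n} → EdgeSet n → Vertex n → Vertex n → Set
C2 M u v = ∃[ i ] ∃[ j ]
  (i ≢ j × v ≡ flipAt u i × AlmostHalfLayer u i ⊆ₑ M ×
   EdgeIn M u (flipAt u j) × EdgeIn M v (flipAt v j))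

C3 : ∀ {n} → EdgeSet n → Vertex n → Vertex n → Set
C3 M u v = EdgeIn M u v

Consecutive : ∀ {A : Set} → List A → A → A → Set
Consecutive P a b = ∃[ xs ] ∃[ ys ] (P ≡ xs ++ a ∷ b ∷ ys)

record HamPath (n : ℕ) (u v : Vertex n) : Set where
  field
    path     : List (Vertex n)
    unique   : Unique path
    spanning : ∀ x → x ∈ path
    linked   : Linked Adjacent path
    start    : head path ≡ just u
    end      : last path ≡ just v

open HamPath public

PathUses : ∀ {n} {u v : Vertex n} → HamPath n u v → Edge n → Set
PathUses P e = Consecutive (path P) (low e) (high e) ⊎ Consecutive (path P) (high e) (low e)

{-# OPTIONS --safe #-}
-- Fix a direction i and a half-layer H in direction i, and call a vertex S if its edge in
-- direction i lies in H, T otherwise.  Flipping a coordinate j ≠ i exchanges S and T, so there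
-- are at most as many S-vertices as T-vertices.  Two vertices with the same label can only be
-- adjacent in direction i, so along a Hamilton path no three consecutive vertices have the same
-- label; and if the path contains every edge of H (C1), or every edge of H but uv (C2), each
-- interior S-vertex has its partner in direction i as a neighbour on the path.  Hence the label
-- word is made of pairs S S separated by blocks T or T T, and the way it starts and ends
-- (S S … S S under C1, S T … S T S under C2) gives more S than T, a contradiction.  Under C3, and
-- in one degenerate case of C2, the path would have at most four of the 2^n vertices of Q_n.
module Submission where

open import Defs
open import Data.Bool using (Bool; true; false; not; _xor_)
open import Data.Bool.Properties
  using (_≟_; not-involutive; not-injective; not-¬; not-distribˡ-xor; not-distribʳ-xor;
         xor-annihilates-not; xor-identityʳ)
open import Data.Empty using (⊥)
open import Data.Fin using (Fin; zero; suc; punchIn)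
import Data.Fin.Properties as Finₚ
open import Data.List using (List; []; _∷_; [_]; _++_; _∷ʳ_; map; length; filter; head; last)
open import Data.List.Properties
  using (∷-injective; ∷-injectiveˡ; ∷ʳ-injectiveʳ; ∷ʳ-++; ++-assoc; ++-identityʳ-unique;
         length-map; length-++; map-++)
open import Data.List.Membership.Propositional using (_∈_)
open import Data.List.Membership.Propositional.Properties
  using (∈-map⁻; ∈-filter⁺; ∈-filter⁻; ∈-∃++; ∈-++⁺ˡ; ∈-++⁺ʳ; ∈-++⁻)
open import Data.List.Relation.Binary.Disjoint.Propositional using (Disjoint)
open import Data.List.Relation.Binary.Subset.Propositional using (_⊆_)
import Data.List.Relation.Unary.All as All
open import Data.List.Relation.Unary.Any using (here; there)
open import Data.List.Relation.Unary.AllPairs using ([]; _∷_)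
open import Data.List.Relation.Unary.Linked as Linked using (Linked)
open import Data.List.Relation.Unary.Unique.Propositional using (Unique)
import Data.List.Relation.Unary.Unique.Propositional.Properties as Unique
open import Data.List.Reverse using (reverseView; []; _∶_∶ʳ_)
open import Data.Maybe using (just)
open import Data.Nat using (ℕ; zero; suc; _+_; _^_; _≤_; _<_; z≤n; s≤s)
open import Data.Nat.Properties
  using (≤-refl; ≤-trans; ≤-pred; m≤n⇒m≤1+n; n≤1+n; m≤m+n; +-identityʳ; +-suc; <⇒≱; ^-monoʳ-≤;
         module ≤-Reasoning)
open import Data.Product using (Σ; ∃-syntax; _×_; _,_; proj₁; proj₂)
import Data.Product as Product
open import Data.Sum using (_⊎_; inj₁; inj₂; swap)
import Data.Sum as Sum
open import Data.Unit using (⊤; tt)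
open import Data.Vec using ([]; _∷_; lookup)
import Data.Vec.Properties as Vecₚ
open import Function using (_∘_; id)
open import Relation.Binary.PropositionalEquality
  using (_≡_; _≢_; refl; sym; trans; cong; cong₂; subst; module ≡-Reasoning)
open import Relation.Nullary using (¬_; yes; no; does; contradiction)
open import Relation.Nullary.Decidable using (dec-true)

private
  variable
    A B : Set
    n : ℕ

Neighbours : List A → A → A → Set
Neighbours L a b = Consecutive L a b ⊎ Consecutive L b a

Window : List A → A → A → A → Set
Window L x y z = ∃[ pre ] ∃[ post ] L ≡ pre ++ x ∷ y ∷ z ∷ post

AllTriples : (A → A → A → Set) → List A → Set
AllTriples R (x ∷ y ∷ z ∷ w) = R x y z × AllTriples R (y ∷ z ∷ w)
AllTriples R _               = ⊤

allTriples-map : ∀ {R : B → B → B → Set} (f : A → B) {L : List A} →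
                 (∀ {x y z} → Window L x y z → R (f x) (f y) (f z)) → AllTriples R (map f L)
allTriples-map f {x ∷ y ∷ z ∷ w} h =
  h ([] , w , refl) , allTriples-map f (λ (pre , post , eq) → h (x ∷ pre , post , cong (x ∷_) eq))
allTriples-map f {[]}         _ = tt
allTriples-map f {_ ∷ []}     _ = tt
allTriples-map f {_ ∷ _ ∷ []} _ = tt

map-++-≡ : ∀ (f : A → B) {L} xs {ys zs} → L ≡ xs ++ ys → map f ys ≡ zs → map f L ≡ map f xs ++ zs
map-++-≡ f xs refl refl = map-++ f xs _

head≡just⇒ : ∀ {xs : List A} {x} → head xs ≡ just x → ∃[ ys ] xs ≡ x ∷ ys
head≡just⇒ {xs = x ∷ ys} refl = ys , refl

last≡just⇒ : ∀ {xs : List A} {x} → last xs ≡ just x → ∃[ ys ] xs ≡ ys ∷ʳ x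
last≡just⇒ {xs = x ∷ []}     refl = [] , refl
last≡just⇒ {xs = y ∷ z ∷ xs} eq   = Product.map (y ∷_) (cong (y ∷_)) (last≡just⇒ {xs = z ∷ xs} eq)

∷ʳ≢[] : ∀ (xs : List A) {x} → xs ∷ʳ x ≢ []
∷ʳ≢[] []      ()
∷ʳ≢[] (_ ∷ _) ()

unique-split : ∀ (xs xs′ : List A) {a ys ys′} → Unique (xs ++ a ∷ ys) →
               xs ++ a ∷ ys ≡ xs′ ++ a ∷ ys′ → xs ≡ xs′ × ys ≡ ys′
unique-split []       []        _       refl = refl , refl
unique-split []       (_ ∷ xs′) u       refl =
  contradiction (∈-++⁺ʳ xs′ (here refl)) (Unique.Unique[x∷xs]⇒x∉xs u)
unique-split (_ ∷ xs) []        u       refl =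
  contradiction (∈-++⁺ʳ xs (here refl)) (Unique.Unique[x∷xs]⇒x∉xs u)
unique-split (x ∷ xs) (_ ∷ xs′) (_ ∷ u) eq with refl , eq′ ← ∷-injective eq =
  Product.map₁ (cong (x ∷_)) (unique-split xs xs′ u eq′)

neighbour-position : ∀ {L : List A} xs {a b ys} → Unique L → L ≡ xs ++ a ∷ ys → Neighbours L a b →
                     (∃[ xs′ ] xs ≡ xs′ ∷ʳ b) ⊎ (∃[ ys′ ] ys ≡ b ∷ ys′)
neighbour-position xs u refl (inj₁ (xs′ , ys′ , eq)) = inj₂ (ys′ , proj₂ (unique-split xs xs′ u eq))
neighbour-position xs {b = b} u refl (inj₂ (xs′ , ys′ , eq)) =
  inj₁ (xs′ , proj₁ (unique-split xs (xs′ ∷ʳ b) u (trans eq (sym (∷ʳ-++ xs′ b _)))))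

linked-consecutive : ∀ {R : A → A → Set} {L a b} → Linked R L → Consecutive L a b → R a b
linked-consecutive l ([]     , _  , refl) = Linked.head l
linked-consecutive l (_ ∷ xs , ys , refl) = linked-consecutive (Linked.tail l) (xs , ys , refl)

module _ {L : List A} {x y z : A} where

  window-consecutive₁ : Window L x y z → Consecutive L x y
  window-consecutive₁ (pre , post , eq) = pre , z ∷ post , eq

  window-consecutive₂ : Window L x y z → Consecutive L y z
  window-consecutive₂ (pre , post , eq) = pre ∷ʳ x , post , trans eq (sym (∷ʳ-++ pre x _))

  window-ends-distinct : Unique L → Window L x y z → x ≢ z
  window-ends-distinct u (pre , post , refl) refl =
    contradiction (++-identityʳ-unique pre (proj₁ (unique-split pre (pre ++ x ∷ y ∷ []) u
                                                     (sym (++-assoc pre (x ∷ y ∷ []) (x ∷ post))))))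
                  λ ()

  window-neighbour : ∀ {w} → Unique L → Window L x y z → Neighbours L y w → w ≡ x ⊎ w ≡ z
  window-neighbour u (pre , post , eq) nb
    with neighbour-position (pre ∷ʳ x) u (trans eq (sym (∷ʳ-++ pre x _))) nb
  ... | inj₁ (pre′ , eq′)  = inj₁ (sym (∷ʳ-injectiveʳ pre pre′ eq′))
  ... | inj₂ (post′ , eq′) = inj₂ (sym (∷-injectiveˡ eq′))

unique-⊆⇒length≤ : ∀ {xs ys : List A} → Unique xs → xs ⊆ ys → length xs ≤ length ys
unique-⊆⇒length≤ {xs = []}     _          _     = z≤n
unique-⊆⇒length≤ {xs = x ∷ xs} (x∉xs ∷ u) xs⊆ys with ∈-∃++ (xs⊆ys (here refl))
... | ys₁ , ys₂ , refl = begin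
  suc (length xs)               ≤⟨ s≤s (unique-⊆⇒length≤ u drop-x) ⟩
  suc (length (ys₁ ++ ys₂))     ≡⟨ cong suc (length-++ ys₁) ⟩
  suc (length ys₁ + length ys₂) ≡⟨ +-suc (length ys₁) (length ys₂) ⟨
  length ys₁ + length (x ∷ ys₂) ≡⟨ length-++ ys₁ ⟨
  length (ys₁ ++ x ∷ ys₂)       ∎
  where
  open ≤-Reasoning
  drop-x : xs ⊆ ys₁ ++ ys₂
  drop-x y∈xs with ∈-++⁻ ys₁ (xs⊆ys (there y∈xs))
  ... | inj₁ y∈ys₁         = ∈-++⁺ˡ y∈ys₁
  ... | inj₂ (here refl)   = contradiction refl (All.lookup x∉xs y∈xs)
  ... | inj₂ (there y∈ys₂) = ∈-++⁺ʳ ys₁ y∈ys₂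

count : Bool → List Bool → ℕ
count b w = length (filter (_≟ b) w)

count-map : ∀ (f : A → Bool) b xs → count b (map f xs) ≡ length (filter (λ x → f x ≟ b) xs)
count-map f b []       = refl
count-map f b (x ∷ xs) with does (f x ≟ b)
... | true  = cong suc (count-map f b xs)
... | false = count-map f b xs

count-true≤count-false : ∀ (f : A → Bool) {φ : A → A} {xs} → (∀ {x y} → φ x ≡ φ y → x ≡ y) →
                         (∀ x → f (φ x) ≡ not (f x)) → Unique xs → (∀ x → x ∈ xs) →
                         count true (map f xs) ≤ count false (map f xs)
count-true≤count-false {A = A} f {φ} {xs} φ-injective f∘φ u spanning = begin
  count true (map f xs)  ≡⟨ count-map f true xs ⟩
  length trues           ≡⟨ length-map φ trues ⟨
  length (map φ trues)   ≤⟨ unique-⊆⇒length≤ (Unique.map⁺ φ-injective (Unique.filter⁺ _ u)) φ[trues]⊆falses ⟩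
  length falses          ≡⟨ count-map f false xs ⟨
  count false (map f xs) ∎
  where
  open ≤-Reasoning
  trues falses : List A
  trues  = filter (λ x → f x ≟ true) xs
  falses = filter (λ x → f x ≟ false) xs
  φ[trues]⊆falses : map φ trues ⊆ falses
  φ[trues]⊆falses y∈ with ∈-map⁻ φ y∈
  ... | x , x∈trues , refl =
    ∈-filter⁺ _ (spanning (φ x)) (trans (f∘φ x) (cong not (proj₂ (∈-filter⁻ _ {xs = xs} x∈trues))))

-- Label words

-- In a label word, true stands for S and false for T.
Admissible : Bool → Bool → Bool → Set
Admissible true  true  true  = ⊥
Admissible false false false = ⊥
Admissible false true  false = ⊥
Admissible _     _     _     = ⊤

admissible-intro : ∀ {a b c} → ¬ (a ≡ b × b ≡ c) → (b ≡ true → a ≡ true ⊎ c ≡ true) →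
                   Admissible a b c
admissible-intro {true}  {true}  {true}  noRun _ = noRun (refl , refl)
admissible-intro {false} {false} {false} noRun _ = noRun (refl , refl)
admissible-intro {false} {true}  {false} _ paired with paired refl
... | inj₁ ()
... | inj₂ ()
admissible-intro {true}  {true}  {false} _ _ = tt
admissible-intro {true}  {false} {true}  _ _ = tt
admissible-intro {true}  {false} {false} _ _ = tt
admissible-intro {false} {true}  {true}  _ _ = tt
admissible-intro {false} {false} {true}  _ _ = tt

-- Suffix _≡_ for the two endings S S and S T S, indexed so that a wrong ending is refuted
-- by unification.
data EndsPaired : List Bool → Set where
  SS    : EndsPaired (true ∷ true ∷ [])
  STS   : EndsPaired (true ∷ false ∷ true ∷ [])
  there : ∀ {x w} → EndsPaired w → EndsPaired (x ∷ w)

endsPaired-++ : ∀ pre {W s} → W ≡ pre ++ s → EndsPaired s → EndsPaired W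
endsPaired-++ []        refl e = e
endsPaired-++ (_ ∷ pre) refl e = there (endsPaired-++ pre refl e)

-- Each recursive step removes a block S S T or S S T T from the front.
pairedWord-excess : ∀ w → AllTriples Admissible (true ∷ true ∷ w) → EndsPaired (true ∷ true ∷ w) →
                    2 + count false (true ∷ true ∷ w) ≤ count true (true ∷ true ∷ w)
pairedWord-excess []                                 _                     _ = ≤-refl
pairedWord-excess (true ∷ _)                         (() , _)              _
pairedWord-excess (false ∷ [])                       _                     (there (there (there ())))
pairedWord-excess (false ∷ true ∷ [])                _                     _ = ≤-refl
pairedWord-excess (false ∷ true ∷ false ∷ _)         (_ , _ , () , _)      _
pairedWord-excess (false ∷ true ∷ true ∷ w)          (_ , _ , _ , adm)     (there (there (there e))) =
  s≤s (m≤n⇒m≤1+n (pairedWord-excess w adm e))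
pairedWord-excess (false ∷ false ∷ [])               _                     (there (there (there (there ()))))
pairedWord-excess (false ∷ false ∷ false ∷ _)        (_ , _ , () , _)      _
pairedWord-excess (false ∷ false ∷ true ∷ [])        _                     (there (there (there (there (there ())))))
pairedWord-excess (false ∷ false ∷ true ∷ false ∷ _) (_ , _ , _ , () , _)  _
pairedWord-excess (false ∷ false ∷ true ∷ true ∷ w)  (_ , _ , _ , _ , adm) (there (there (there (there e)))) =
  s≤s (s≤s (pairedWord-excess w adm e))

surplus-SS : ∀ {W} w → W ≡ true ∷ true ∷ w → AllTriples Admissible W → EndsPaired W →
             count false W < count true W
surplus-SS w refl adm ends = ≤-trans (n≤1+n _) (pairedWord-excess w adm ends)

-- A virtual S in front makes the first letter part of a pair.
surplus-ST : ∀ {W} w → W ≡ true ∷ false ∷ w → AllTriples Admissible W → EndsPaired W →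
             count false W < count true W
surplus-ST w refl adm ends = ≤-pred (pairedWord-excess (false ∷ w) (tt , adm) (there ends))

-- The hypercube

flipAt-involutive : (x : Vertex n) (i : Fin n) → flipAt (flipAt x i) i ≡ x
flipAt-involutive x i =
  trans (Vecₚ.updateAt-updateAt i x) (Vecₚ.updateAt-id-local i x (not-involutive (lookup x i)))

flipAt-comm : (x : Vertex n) {i j : Fin n} → i ≢ j → flipAt (flipAt x j) i ≡ flipAt (flipAt x i) j
flipAt-comm x {i} {j} i≢j = Vecₚ.updateAt-commutes i j i≢j x

flipAt-injective : (i : Fin n) {x y : Vertex n} → flipAt x i ≡ flipAt y i → x ≡ y
flipAt-injective i {x} {y} eq = begin
  x                     ≡⟨ flipAt-involutive x i ⟨
  flipAt (flipAt x i) i ≡⟨ cong (λ z → flipAt z i) eq ⟩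
  flipAt (flipAt y i) i ≡⟨ flipAt-involutive y i ⟩
  y                     ∎
  where open ≡-Reasoning

parity-flipAt : (x : Vertex n) (i : Fin n) → parity (flipAt x i) ≡ not (parity x)
parity-flipAt (b ∷ x) zero    = sym (not-distribˡ-xor b (parity x))
parity-flipAt (b ∷ x) (suc i) =
  trans (cong (b xor_) (parity-flipAt x i)) (sym (not-distribʳ-xor b (parity x)))

-- The parity p of the half-layer in direction i that contains the edge x x^i.
layer : Fin n → Vertex n → Bool
layer i x = parity x xor lookup x i

layer-flipAt-same : (x : Vertex n) (i : Fin n) → layer i (flipAt x i) ≡ layer i x
layer-flipAt-same x i =
  trans (cong₂ _xor_ (parity-flipAt x i) (Vecₚ.lookup∘updateAt i x))
        (xor-annihilates-not (parity x) (lookup x i))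

layer-flipAt-other : (x : Vertex n) {i j : Fin n} → i ≢ j → layer i (flipAt x j) ≡ not (layer i x)
layer-flipAt-other x {i} {j} i≢j =
  trans (cong₂ _xor_ (parity-flipAt x j) (Vecₚ.lookup∘updateAt′ i j i≢j x))
        (sym (not-distribˡ-xor (parity x) (lookup x i)))

layer-low : (x : Vertex n) (i : Fin n) → lookup x i ≡ false → layer i x ≡ parity x
layer-low x i x₀ = trans (cong (parity x xor_) x₀) (xor-identityʳ (parity x))

lookup-lowEnd : (x : Vertex n) (i : Fin n) → lookup (lowEnd x i) i ≡ false
lookup-lowEnd x i with lookup x i in eq
... | true  = trans (Vecₚ.lookup∘updateAt i x) (cong not eq)
... | false = eq

lowEnd-cases : (x : Vertex n) (i : Fin n) → lowEnd x i ≡ x ⊎ lowEnd x i ≡ flipAt x i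
lowEnd-cases x i with lookup x i
... | true  = inj₂ refl
... | false = inj₁ refl

layer-lowEnd : (x : Vertex n) (i : Fin n) → layer i (lowEnd x i) ≡ layer i x
layer-lowEnd x i with lowEnd-cases x i
... | inj₁ eq = cong (layer i) eq
... | inj₂ eq = trans (cong (layer i) eq) (layer-flipAt-same x i)

parity-lowEnd : (x : Vertex n) (i : Fin n) → parity (lowEnd x i) ≡ layer i x
parity-lowEnd x i = trans (sym (layer-low (lowEnd x i) i (lookup-lowEnd x i))) (layer-lowEnd x i)

edgeAt : Vertex n → Fin n → Edge n
edgeAt x i = edge (lowEnd x i) i (lookup-lowEnd x i)

edgeAt-joins : (x : Vertex n) (i : Fin n) → Joins (edgeAt x i) x (flipAt x i)
edgeAt-joins x i with lookup x i
... | true  = inj₂ (sym (flipAt-involutive x i) , refl)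
... | false = inj₁ (refl , refl)

halfLayer-endpoint : ∀ {i p} {e : Edge n} {x} → HalfLayer i p e → Endpoint e x →
                     Joins e x (flipAt x i) × layer i x ≡ p
halfLayer-endpoint {e = edge l i l₀} (refl , refl) (inj₁ refl) = inj₁ (refl , refl) , layer-low l i l₀
halfLayer-endpoint {e = edge l i l₀} (refl , refl) (inj₂ refl) =
  inj₂ (refl , flipAt-involutive l i) , trans (layer-flipAt-same l i) (layer-low l i l₀)

joins-neighbours : ∀ {e : Edge n} {L a b} → Joins e a b → Neighbours L (low e) (high e) →
                   Neighbours L a b
joins-neighbours (inj₁ (refl , refl)) = id
joins-neighbours (inj₂ (refl , refl)) = swap

joins-endpoint : ∀ {e : Edge n} {a b c d} → Joins e a b → Joins e c d → a ≡ c ⊎ a ≡ d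
joins-endpoint (inj₁ (refl , refl)) (inj₁ (refl , refl)) = inj₁ refl
joins-endpoint (inj₁ (refl , refl)) (inj₂ (refl , refl)) = inj₂ refl
joins-endpoint (inj₂ (refl , refl)) (inj₁ (refl , refl)) = inj₂ refl
joins-endpoint (inj₂ (refl , refl)) (inj₂ (refl , refl)) = inj₁ refl

inHalfLayer : Fin n → Bool → Vertex n → Bool
inHalfLayer i p x = does (layer i x ≟ p)

module _ {i : Fin n} {p : Bool} where

  inHalfLayer-intro : ∀ x → layer i x ≡ p → inHalfLayer i p x ≡ true
  inHalfLayer-intro x = dec-true (layer i x ≟ p)

  inHalfLayer⇒layer : ∀ x → inHalfLayer i p x ≡ true → layer i x ≡ p
  inHalfLayer⇒layer x lx with layer i x ≟ p
  ... | yes eq = eq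

  inHalfLayer-flipAt-same : ∀ x → inHalfLayer i p (flipAt x i) ≡ inHalfLayer i p x
  inHalfLayer-flipAt-same x = cong (λ b → does (b ≟ p)) (layer-flipAt-same x i)

  inHalfLayer-flipAt-other : ∀ x {j} → i ≢ j → inHalfLayer i p (flipAt x j) ≡ not (inHalfLayer i p x)
  inHalfLayer-flipAt-other x i≢j =
    trans (cong (λ b → does (b ≟ p)) (layer-flipAt-other x i≢j)) (does-not (layer i x) p)
    where
    does-not : ∀ a b → does (not a ≟ b) ≡ not (does (a ≟ b))
    does-not true  true  = refl
    does-not true  false = refl
    does-not false true  = refl
    does-not false false = refl

  inHalfLayer-flipAt-stable : ∀ x {j} → inHalfLayer i p (flipAt x j) ≡ inHalfLayer i p x → j ≡ i
  inHalfLayer-flipAt-stable x {j} eq with i Finₚ.≟ j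
  ... | yes refl = refl
  ... | no i≢j   = contradiction (trans (sym eq) (inHalfLayer-flipAt-other x i≢j)) (not-¬ refl)

  edgeAt-∈-HalfLayer : ∀ x → inHalfLayer i p x ≡ true → HalfLayer i p (edgeAt x i)
  edgeAt-∈-HalfLayer x lx = refl , trans (parity-lowEnd x i) (inHalfLayer⇒layer x lx)

otherDirection : 2 ≤ n → (i : Fin n) → ∃[ j ] i ≢ j
otherDirection (s≤s (s≤s _)) i = punchIn i zero , Finₚ.punchInᵢ≢i i zero ∘ sym

vertices : (n : ℕ) → List (Vertex n)
vertices zero    = [ [] ]
vertices (suc n) = map (false ∷_) (vertices n) ++ map (true ∷_) (vertices n)

vertices-unique : ∀ n → Unique (vertices n)
vertices-unique zero    = All.[] ∷ []
vertices-unique (suc n) =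
  Unique.++⁺ (Unique.map⁺ Vecₚ.∷-injectiveʳ u) (Unique.map⁺ Vecₚ.∷-injectiveʳ u) disjoint
  where
  u : Unique (vertices n)
  u = vertices-unique n
  disjoint : Disjoint (map (false ∷_) (vertices n)) (map (true ∷_) (vertices n))
  disjoint (x∈F , x∈T) with ∈-map⁻ _ x∈F | ∈-map⁻ _ x∈T
  ... | _ , _ , refl | _ , _ , ()

length-vertices : ∀ n → length (vertices n) ≡ 2 ^ n
length-vertices zero    = refl
length-vertices (suc n) = begin
  length (map (false ∷_) V ++ map (true ∷_) V)         ≡⟨ length-++ (map (false ∷_) V) ⟩
  length (map (false ∷_) V) + length (map (true ∷_) V) ≡⟨ cong₂ _+_ (length-map _ V) (length-map _ V) ⟩
  length V + length V                                  ≡⟨ cong (λ k → k + k) (length-vertices n) ⟩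
  2 ^ n + 2 ^ n                                        ≡⟨ cong (2 ^ n +_) (+-identityʳ (2 ^ n)) ⟨
  2 ^ suc n                                            ∎
  where
  open ≡-Reasoning
  V : List (Vertex n)
  V = vertices n

-- Hamilton paths

UsesAll : ∀ {u v} → HamPath n u v → EdgeSet n → Set
UsesAll P M = ∀ e → M e → PathUses P e

module _ {u v : Vertex n} (P : HamPath n u v) where

  usedEdge-neighbours : ∀ {M e a b} → UsesAll P M → M e → Joins e a b → Neighbours (path P) a b
  usedEdge-neighbours {e = e} uses e∈M joins = joins-neighbours {e = e} joins (uses e e∈M)

  hamPath-length : ∀ {xs} → path P ≡ xs → 2 ^ n ≤ length xs
  hamPath-length refl = subst (_≤ length (path P)) (length-vertices n)
                              (unique-⊆⇒length≤ (vertices-unique n) (λ {x} _ → spanning P x))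

  halfLayer-balanced : ∀ {i j p} → i ≢ j →
    count true (map (inHalfLayer i p) (path P)) ≤ count false (map (inHalfLayer i p) (path P))
  halfLayer-balanced {j = j} i≢j =
    count-true≤count-false _ (flipAt-injective j) (λ x → inHalfLayer-flipAt-other x i≢j)
                           (unique P) (spanning P)

  positions-unique : ∀ xs xs′ {a ys ys′} → path P ≡ xs ++ a ∷ ys → path P ≡ xs′ ++ a ∷ ys′ →
                     xs ≡ xs′ × ys ≡ ys′
  positions-unique xs xs′ eq eq′ =
    unique-split xs xs′ (subst Unique eq (unique P)) (trans (sym eq) eq′)

  path-start : ∃[ r ] path P ≡ u ∷ r
  path-start = head≡just⇒ (start P)

  path-end : ∃[ pre ] path P ≡ pre ∷ʳ v
  path-end = last≡just⇒ (end P)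

  start-neighbour : ∀ {w} → Neighbours (path P) u w → ∃[ r ] path P ≡ u ∷ w ∷ r
  start-neighbour nb with r , eq ← path-start with neighbour-position [] (unique P) eq nb
  ... | inj₁ (xs′ , []≡xs′∷ʳw) = contradiction (sym []≡xs′∷ʳw) (∷ʳ≢[] xs′)
  ... | inj₂ (r′ , refl)       = r′ , eq

  end-neighbour : ∀ {w} → Neighbours (path P) v w → ∃[ pre ] path P ≡ pre ++ w ∷ v ∷ []
  end-neighbour {w} nb with pre , eq ← path-end with neighbour-position pre (unique P) eq nb
  ... | inj₁ (pre′ , refl) = pre′ , trans eq (∷ʳ-++ pre′ w (v ∷ []))
  ... | inj₂ (_ , ())

  window-interior : ∀ {x y z} → Window (path P) x y z → y ≢ u × y ≢ v
  window-interior {x} {y} {z} (pre , post , eq) = y≢u , y≢v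
    where
    eq′ : path P ≡ (pre ∷ʳ x) ++ y ∷ z ∷ post
    eq′ = trans eq (sym (∷ʳ-++ pre x _))
    y≢u : y ≢ u
    y≢u refl = ∷ʳ≢[] pre (proj₁ (positions-unique (pre ∷ʳ x) [] eq′ (proj₂ path-start)))
    y≢v : y ≢ v
    y≢v refl =
      contradiction (proj₂ (positions-unique (pre ∷ʳ x) (proj₁ path-end) eq′ (proj₂ path-end))) λ ()

  labels-admissible : ∀ {i p} →
    (∀ {y} → y ≢ u → y ≢ v → inHalfLayer i p y ≡ true → Neighbours (path P) y (flipAt y i)) →
    AllTriples Admissible (map (inHalfLayer i p) (path P))
  labels-admissible {i} {p} paired =
    allTriples-map lab (λ w → admissible-intro (noRun w) (pairedMiddle w))
    where
    lab : Vertex n → Bool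
    lab = inHalfLayer i p
    noRun : ∀ {x y z} → Window (path P) x y z → ¬ (lab x ≡ lab y × lab y ≡ lab z)
    noRun {x} w (xy , yz)
      with a , refl ← linked-consecutive (linked P) (window-consecutive₁ w)
         | b , refl ← linked-consecutive (linked P) (window-consecutive₂ w)
      with refl ← inHalfLayer-flipAt-stable x (sym xy)
         | refl ← inHalfLayer-flipAt-stable (flipAt x a) (sym yz)
      = window-ends-distinct (unique P) w (sym (flipAt-involutive x i))
    pairedMiddle : ∀ {x y z} → Window (path P) x y z → lab y ≡ true → lab x ≡ true ⊎ lab z ≡ true
    pairedMiddle {y = y} w ly =
      Sum.map partner partner
        (window-neighbour (unique P) w (paired (proj₁ (window-interior w)) (proj₂ (window-interior w)) ly))
      where
      partner : ∀ {t} → flipAt y i ≡ t → lab t ≡ true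
      partner refl = trans (inHalfLayer-flipAt-same y) ly

-- The conditions C1, C2, C3

C1⇒¬UsesAll : ∀ {M : EdgeSet n} {u v} → 2 ≤ n → C1 M u v → (P : HamPath n u v) → ¬ UsesAll P M
C1⇒¬UsesAll {n} {u = u} {v} 2≤n (i , p , H⊆M , (e , e∈H , u∈e) , (f , f∈H , v∈f)) P uses =
  <⇒≱ surplus (halfLayer-balanced P (proj₂ (otherDirection 2≤n i)))
  where
  lab : Vertex n → Bool
  lab = inHalfLayer i p

  covered : ∀ g {x} → HalfLayer i p g → Endpoint g x →
            Neighbours (path P) x (flipAt x i) × lab x ≡ true × lab (flipAt x i) ≡ true
  covered g {x} g∈H x∈g with x-joins , x-layer ← halfLayer-endpoint {e = g} g∈H x∈g =
    usedEdge-neighbours P uses (H⊆M g g∈H) x-joins ,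
    inHalfLayer-intro x x-layer ,
    trans (inHalfLayer-flipAt-same x) (inHalfLayer-intro x x-layer)

  paired : ∀ {y} → y ≢ u → y ≢ v → lab y ≡ true → Neighbours (path P) y (flipAt y i)
  paired {y} _ _ ly =
    usedEdge-neighbours P uses (H⊆M (edgeAt y i) (edgeAt-∈-HalfLayer y ly)) (edgeAt-joins y i)

  surplus : count false (map lab (path P)) < count true (map lab (path P))
  surplus
    with u-nb , lab-u , lab-uⁱ ← covered e e∈H u∈e
       | v-nb , lab-v , lab-vⁱ ← covered f f∈H v∈f
    with r , start≡ ← start-neighbour P u-nb
       | pre , end≡ ← end-neighbour P v-nb
    = surplus-SS _ (map-++-≡ lab [] start≡ (cong₂ _∷_ lab-u (cong₂ _∷_ lab-uⁱ refl)))
                   (labels-admissible P paired)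
                   (endsPaired-++ (map lab pre)
                                  (map-++-≡ lab pre end≡ (cong₂ _∷_ lab-vⁱ (cong₂ _∷_ lab-v refl))) SS)

C2⇒¬UsesAll : ∀ {M : EdgeSet n} {u v} → 3 ≤ n → C2 M u v → (P : HamPath n u v) → ¬ UsesAll P M
C2⇒¬UsesAll {n} {u = u} 3≤n
            (i , j , i≢j , refl , almost⊆M , (e , e∈M , e-joins) , (f , f∈M , f-joins)) P uses =
  <⇒≱ surplus (halfLayer-balanced P i≢j)
  where
  v uʲ vʲ : Vertex n
  v  = flipAt u i
  uʲ = flipAt u j
  vʲ = flipAt v j

  lab : Vertex n → Bool
  lab = inHalfLayer i (layer i u)

  lab-u : lab u ≡ true
  lab-u = inHalfLayer-intro u refl
  lab-v : lab v ≡ true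
  lab-v = trans (inHalfLayer-flipAt-same u) lab-u
  lab-uʲ : lab uʲ ≡ false
  lab-uʲ = trans (inHalfLayer-flipAt-other u i≢j) (cong not lab-u)
  lab-vʲ : lab vʲ ≡ false
  lab-vʲ = trans (inHalfLayer-flipAt-other v i≢j) (cong not lab-v)

  vʲ≢u : vʲ ≢ u
  vʲ≢u eq = contradiction (trans (sym lab-vʲ) (trans (cong lab eq) lab-u)) λ ()

  begins : ∃[ r ] path P ≡ u ∷ uʲ ∷ r
  begins = start-neighbour P (usedEdge-neighbours P uses e∈M e-joins)

  ends : ∃[ pre ] path P ≡ pre ++ vʲ ∷ v ∷ []
  ends = end-neighbour P (usedEdge-neighbours P uses f∈M f-joins)

  paired : ∀ {y} → y ≢ u → y ≢ v → lab y ≡ true → Neighbours (path P) y (flipAt y i)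
  paired {y} y≢u y≢v ly =
    usedEdge-neighbours P uses (almost⊆M (edgeAt y i) (inLayer , avoids)) (edgeAt-joins y i)
    where
    inLayer : HalfLayer i (parity (lowEnd u i)) (edgeAt y i)
    inLayer = refl , trans (parity-lowEnd y i) (trans (inHalfLayer⇒layer y ly) (sym (parity-lowEnd u i)))
    avoids : ¬ Joins (edgeAt y i) u v
    avoids uv = Sum.[ y≢u , y≢v ] (joins-endpoint {e = edgeAt y i} (edgeAt-joins y i) uv)

  iPartner-of-vʲ : ∀ {y} → vʲ ≡ flipAt y i → uʲ ≡ y
  iPartner-of-vʲ {y} vʲ≡yⁱ = begin
    uʲ                    ≡⟨ cong (λ t → flipAt t j) (flipAt-involutive u i) ⟨
    flipAt (flipAt v i) j ≡⟨ flipAt-comm v i≢j ⟨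
    flipAt vʲ i           ≡⟨ cong (λ t → flipAt t i) vʲ≡yⁱ ⟩
    flipAt (flipAt y i) i ≡⟨ flipAt-involutive y i ⟩
    y                     ∎
    where open ≡-Reasoning

  -- If it were, y = u^j and the path would be u, u^j, v^j, v.
  no-i-step-into-vʲ : ∀ {pre y} → path P ≡ pre ++ y ∷ vʲ ∷ v ∷ [] → vʲ ≢ flipAt y i
  no-i-step-into-vʲ {pre} end≡ vʲ≡yⁱ
    with refl ← iPartner-of-vʲ vʲ≡yⁱ
    with refl ← proj₁ (positions-unique P pre [ u ] end≡ (proj₂ begins))
    = <⇒≱ (≤-trans (m≤m+n 5 3) (^-monoʳ-≤ 2 3≤n)) (hamPath-length P end≡)

  predecessor-in-layer : ∀ {pre y} → path P ≡ pre ++ y ∷ vʲ ∷ v ∷ [] → lab y ≡ true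
  predecessor-in-layer {pre} {y} end≡
    with a , vʲ≡yᵃ ← linked-consecutive (linked P) (pre , v ∷ [] , end≡)
    with i Finₚ.≟ a
  ... | yes refl = contradiction vʲ≡yᵃ (no-i-step-into-vʲ end≡)
  ... | no i≢a   =
    not-injective (trans (sym (inHalfLayer-flipAt-other y i≢a)) (trans (cong lab (sym vʲ≡yᵃ)) lab-vʲ))

  penultimate : ∃[ pre ] ∃[ y ] path P ≡ pre ++ y ∷ vʲ ∷ v ∷ [] × lab y ≡ true
  penultimate with pre , end≡ ← ends with reverseView pre
  ... | [] = contradiction (∷-injectiveˡ (trans (sym end≡) (proj₂ begins))) vʲ≢u
  ... | pre′ ∶ _ ∶ʳ y = pre′ , y , end≡′ , predecessor-in-layer end≡′
    where
    end≡′ : path P ≡ pre′ ++ y ∷ vʲ ∷ v ∷ []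
    end≡′ = trans end≡ (∷ʳ-++ pre′ y _)

  surplus : count false (map lab (path P)) < count true (map lab (path P))
  surplus with r , start≡ ← begins | pre , y , end≡ , lab-y ← penultimate =
    surplus-ST _ (map-++-≡ lab [] start≡ (cong₂ _∷_ lab-u (cong₂ _∷_ lab-uʲ refl)))
                 (labels-admissible P paired)
                 (endsPaired-++ (map lab pre) (map-++-≡ lab pre end≡ labels-end) STS)
    where
    labels-end : map lab (y ∷ vʲ ∷ v ∷ []) ≡ true ∷ false ∷ true ∷ []
    labels-end = cong₂ _∷_ lab-y (cong₂ _∷_ lab-vʲ (cong (_∷ []) lab-v))

C3⇒¬UsesAll : ∀ {M : EdgeSet n} {u v} → 2 ≤ n → C3 M u v → (P : HamPath n u v) → ¬ UsesAll P M
C3⇒¬UsesAll {u = u} 2≤n (e , e∈M , e-joins) P uses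
  with r , start≡ ← start-neighbour P (usedEdge-neighbours P uses e∈M e-joins)
  with pre , end≡ ← path-end P
  with refl ← proj₂ (positions-unique P [ u ] pre start≡ end≡)
  = <⇒≱ (≤-trans (n≤1+n 3) (^-monoʳ-≤ 2 2≤n)) (hamPath-length P start≡)

mainTheorem5 : (n : ℕ) → 5 ≤ n → (u v : Vertex n) → parity u ≢ parity v →
               (M : EdgeSet n) → IsMatching M →
               (C1 M u v ⊎ C2 M u v ⊎ C3 M u v) →
               ¬ (Σ (HamPath n u v) λ P → ∀ e → M e → PathUses P e)
mainTheorem5 n 5≤n u v _ M _ (inj₁ c1)        (P , uses) = C1⇒¬UsesAll (≤-trans (m≤m+n 2 3) 5≤n) c1 P uses
mainTheorem5 n 5≤n u v _ M _ (inj₂ (inj₁ c2)) (P , uses) = C2⇒¬UsesAll (≤-trans (m≤m+n 3 2) 5≤n) c2 P uses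
mainTheorem5 n 5≤n u v _ M _ (inj₂ (inj₂ c3)) (P , uses) = C3⇒¬UsesAll (≤-trans (m≤m+n 2 3) 5≤n) c3 P uses
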